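{- Let $(L,\vee,\wedge,{}^*,0,1)$ be a pseudocomplemented lattice satisfying the Stone identity $x^*\vee x^{**}=1$ for all $x\in L$, define $x\Rightarrow y:=x^*\vee y^{**}$, and let $a,b\in L$. Then: (i) if $a\le b^{**}$ then $a\Rightarrow b=1$; (ii) $a\Rightarrow(b\Rightarrow a)=1$.
   Context: A bounded lattice $(L,\vee,\wedge,0,1)$ is pseudocomplemented if for each $a\in L$ there is a greatest element $a^*\in L$ with $a\wedge a^*=0$; $a^*$ is the pseudocomplement of $a$. The lattice is not assumed distributive. -}

module Defs where

open import Level using (Level)
open import Data.Product using (_×_)
open import Relation.Binary.Lattice.Bundles using (BoundedLattice)

IsPseudocomplement : ∀ {c ℓ₁ ℓ₂} (L : BoundedLattice c ℓ₁ ℓ₂) →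
                     (BoundedLattice.Carrier L → BoundedLattice.Carrier L) → Set _
IsPseudocomplement L _* =
  ∀ a → ((a ∧ (a *)) ≈ ⊥) × (∀ x → (a ∧ x) ≈ ⊥ → x ≤ (a *))
  where open BoundedLattice L

StoneIdentity : ∀ {c ℓ₁ ℓ₂} (L : BoundedLattice c ℓ₁ ℓ₂) →
                (BoundedLattice.Carrier L → BoundedLattice.Carrier L) → Set _
StoneIdentity L _* = ∀ x → ((x *) ∨ ((x *) *)) ≈ ⊤
  where open BoundedLattice L

implies : ∀ {c ℓ₁ ℓ₂} (L : BoundedLattice c ℓ₁ ℓ₂) →
          (BoundedLattice.Carrier L → BoundedLattice.Carrier L) →
          BoundedLattice.Carrier L → BoundedLattice.Carrier L → BoundedLattice.Carrier L
implies L _* x y = (x *) ∨ ((y *) *)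
  where open BoundedLattice L

-- Both implications equal ⊤ because each dominates a Stone join x* ∨ x**:
-- (i) a* ∨ b** ⊇ b* ∨ b**, since a ≤ b** gives b* = b*** ≤ a*;
-- (ii) a* ∨ (b* ∨ a**)** ⊇ a* ∨ a**, since a** ≤ b* ∨ a** ≤ (b* ∨ a**)**.
module Submission where

open import Defs
open import Data.Product using (_×_; _,_; proj₁; proj₂)
open import Relation.Binary.Lattice.Bundles using (BoundedLattice)
import Relation.Binary.Reasoning.PartialOrder as PosetReasoning
import Relation.Binary.Lattice.Properties.JoinSemilattice as JoinSemilatticeProperties

module Pseudocomplemented {c ℓ₁ ℓ₂} (L : BoundedLattice c ℓ₁ ℓ₂)
  (_* : BoundedLattice.Carrier L → BoundedLattice.Carrier L)
  (isPseudocomplement : IsPseudocomplement L _*) where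

  open BoundedLattice L
  open JoinSemilatticeProperties joinSemilattice using (∨-monotonic)

  ≤⊥⇒≈⊥ : ∀ {x} → x ≤ ⊥ → x ≈ ⊥
  ≤⊥⇒≈⊥ x≤⊥ = antisym x≤⊥ (minimum _)

  ⊤≤⇒≈⊤ : ∀ {x} → ⊤ ≤ x → x ≈ ⊤
  ⊤≤⇒≈⊤ ⊤≤x = antisym (maximum _) ⊤≤x

  x∧x*≈⊥ : ∀ x → x ∧ (x *) ≈ ⊥
  x∧x*≈⊥ x = proj₁ (isPseudocomplement x)

  x∧y≈⊥⇒y≤x* : ∀ {x y} → x ∧ y ≈ ⊥ → y ≤ (x *)
  x∧y≈⊥⇒y≤x* {x} {y} = proj₂ (isPseudocomplement x) y

  x≤x** : ∀ x → x ≤ ((x *) *)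
  x≤x** x = x∧y≈⊥⇒y≤x* (≤⊥⇒≈⊥ (begin
    (x *) ∧ x  ≤⟨ ∧-greatest (x∧y≤y _ _) (x∧y≤x _ _) ⟩
    x ∧ (x *)  ≈⟨ x∧x*≈⊥ x ⟩
    ⊥          ∎))
    where open PosetReasoning poset

  *-antitone : ∀ {x y} → x ≤ y → (y *) ≤ (x *)
  *-antitone {x} {y} x≤y = x∧y≈⊥⇒y≤x* (≤⊥⇒≈⊥ (begin
    x ∧ (y *)  ≤⟨ ∧-greatest (trans (x∧y≤x _ _) x≤y) (x∧y≤y _ _) ⟩
    y ∧ (y *)  ≈⟨ x∧x*≈⊥ y ⟩
    ⊥          ∎))
    where open PosetReasoning poset

  module Stone (stoneIdentity : StoneIdentity L _*) where

    stone-≤⇒∨≈⊤ : ∀ x {u v} → (x *) ≤ u → ((x *) *) ≤ v → u ∨ v ≈ ⊤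
    stone-≤⇒∨≈⊤ x x*≤u x**≤v = ⊤≤⇒≈⊤ (begin
      ⊤                  ≈⟨ Eq.sym (stoneIdentity x) ⟩
      (x *) ∨ ((x *) *)  ≤⟨ ∨-monotonic x*≤u x**≤v ⟩
      _                  ∎)
      where open PosetReasoning poset

    ≤**⇒⇒≈⊤ : ∀ a b → a ≤ ((b *) *) → implies L _* a b ≈ ⊤
    ≤**⇒⇒≈⊤ a b a≤b** =
      stone-≤⇒∨≈⊤ b (trans (x≤x** (b *)) (*-antitone a≤b**)) refl

    ⇒-weakening≈⊤ : ∀ a b → implies L _* a (implies L _* b a) ≈ ⊤
    ⇒-weakening≈⊤ a b =
      stone-≤⇒∨≈⊤ a refl (trans (y≤x∨y (b *) _) (x≤x** _))

lemma4p4 : ∀ {c ℓ₁ ℓ₂} (L : BoundedLattice c ℓ₁ ℓ₂) →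
    (_* : BoundedLattice.Carrier L → BoundedLattice.Carrier L) →
    IsPseudocomplement L _* →
    StoneIdentity L _* →
    (a b : BoundedLattice.Carrier L) →
    (BoundedLattice._≤_ L a ((b *) *) →
      BoundedLattice._≈_ L (implies L _* a b) (BoundedLattice.⊤ L))
    × BoundedLattice._≈_ L (implies L _* a (implies L _* b a)) (BoundedLattice.⊤ L)
lemma4p4 L _* isPseudocomplement stoneIdentity a b =
  ≤**⇒⇒≈⊤ a b , ⇒-weakening≈⊤ a b
  where open Pseudocomplemented.Stone L _* isPseudocomplement stoneIdentity
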